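{- For every PCoR* term $t$ over $\Sigma$ and every graph $G \in \mathcal{G}(t)$, the pathwidth of $G$ is at most $\mathrm{iw}(t)$.
   Context: PCoR* terms over $\Sigma$: $t ::= a \mid 1 \mid 0 \mid \top \mid t;t \mid t+t \mid t\cap t \mid t^{\smile} \mid t^{*}$, $a\in\Sigma$. Intersection width: $\mathrm{iw}(u)=1$ for $u\in\Sigma\cup\{1,0,\top\}$; $\mathrm{iw}(t^{\smile})=\mathrm{iw}(t^{*})=\mathrm{iw}(t)$; $\mathrm{iw}(t;s)=\mathrm{iw}(t+s)=\max(\mathrm{iw}(t),\mathrm{iw}(s))$; $\mathrm{iw}(t\cap s)=\mathrm{iw}(t)+\mathrm{iw}(s)$. A graph over $\Sigma$ is $G=(|G|,(a^G)_{a\in\Sigma},\mathrm{src}^G,\mathrm{tgt}^G)$ with $a^G\subseteq|G|^2$ and source/target $\mathrm{src}^G,\mathrm{tgt}^G\in|G|$, identified up to isomorphism. Series composition $G;H$: disjoint union with $\mathrm{tgt}^G$ and $\mathrm{src}^H$ identified (source of $G$, target of $H$). Parallel composition $G\parallel H$: disjoint union with sources identified and targets identified. Graph language: $\mathcal G(a)$ = single edge $u\xrightarrow{a}v$ from source $u$ to target $v\ne u$; $\mathcal G(1)$ = one vertex, no edges, source = target; $\mathcal G(0)=\emptyset$; $\mathcal G(\top)$ = two distinct isolated vertices (source and target); $\mathcal G(t^{\smile})$ = graphs of $\mathcal G(t)$ with source and target swapped; $\mathcal G(t\cap s)=\{G\parallel H\}$, $\mathcal G(t;s)=\{G;H\}$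 over $G\in\mathcal G(t),H\in\mathcal G(s)$; $\mathcal G(t+s)=\mathcal G(t)\cup\mathcal G(s)$; $\mathcal G(t^{*})=\bigcup_{n\ge0}\mathcal G(t^n)$ with $t^0=1$, $t^n=t;t^{n-1}$. A path decomposition of a finite graph $G$ is a sequence $(U_1,\dots,U_n)$ of subsets of $|G|$ with $\bigcup_i U_i=|G|$, every pair $(x,y)\in a^G$ ($a\in\Sigma$) contained in some $U_i$, and $U_i\cap U_k\subseteq U_j$ for $i\le j\le k$; its width is $\max_i(\#U_i-1)$, and the pathwidth of $G$ is the minimum width of a path decomposition (source and target are ignored). -}

module Defs where

open import Level using (0ℓ)
open import Data.Nat using (ℕ; zero; suc; _≤_; _⊔_; _∸_; _+_)
open import Data.Fin using (Fin)
import Data.Fin as F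
open import Data.Fin.Subset using (Subset; _∈_; ∣_∣)
open import Data.Sum using (_⊎_; inj₁; inj₂)
open import Data.Product using (Σ; ∃; ∃-syntax; _×_; _,_)
open import Data.Empty using (⊥)
open import Data.List using (List; foldr; tabulate)
open import Relation.Nullary using (¬_)
open import Relation.Binary.PropositionalEquality using (_≡_; _≢_)
open import Relation.Binary.Construct.Closure.Equivalence using (EqClosure)
open import Function.Bundles using (_⇔_)

data Term (A : Set) : Set where
  atom : A → Term A
  one  : Term A
  zer  : Term A
  top  : Term A
  _⨾_  : Term A → Term A → Term A
  _⊕_  : Term A → Term A → Term A
  _⊓_  : Term A → Term A → Term A
  _˘   : Term A → Term A
  _⋆   : Term A → Term A

iw : {A : Set} → Term A → ℕ
iw (atom a) = 1
iw one      = 1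
iw zer      = 1
iw top      = 1
iw (t ⨾ s)  = iw t ⊔ iw s
iw (t ⊕ s)  = iw t ⊔ iw s
iw (t ⊓ s)  = iw t + iw s
iw (t ˘)    = iw t
iw (t ⋆)    = iw t

pow : {A : Set} → Term A → ℕ → Term A
pow t zero    = one
pow t (suc n) = t ⨾ pow t n

record Graph (A : Set) : Set₁ where
  field
    size : ℕ
    edge : A → Fin size → Fin size → Set
    src  : Fin size
    tgt  : Fin size
open Graph public

swap : {A : Set} → Graph A → Graph A
swap G = record { size = size G ; edge = edge G ; src = tgt G ; tgt = src G }

SumEdge : {A : Set} (H K : Graph A) → A →
          Fin (size H) ⊎ Fin (size K) → Fin (size H) ⊎ Fin (size K) → Set
SumEdge H K a (inj₁ x) (inj₁ y) = edge H a x y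
SumEdge H K a (inj₂ x) (inj₂ y) = edge K a x y
SumEdge H K a _        _        = ⊥

data SeriesGen {A : Set} (H K : Graph A) :
     Fin (size H) ⊎ Fin (size K) → Fin (size H) ⊎ Fin (size K) → Set where
  glue : SeriesGen H K (inj₁ (tgt H)) (inj₂ (src K))

data ParGen {A : Set} (H K : Graph A) :
     Fin (size H) ⊎ Fin (size K) → Fin (size H) ⊎ Fin (size K) → Set where
  glueSrc : ParGen H K (inj₁ (src H)) (inj₂ (src K))
  glueTgt : ParGen H K (inj₁ (tgt H)) (inj₂ (tgt K))

-- G is (isomorphic to) the quotient of the disjoint union H ⊎ K by the
-- equivalence relation generated by R, with the given source and target,
-- witnessed by the quotient map h.
record IsGluing {A : Set} (H K : Graph A)
         (R : Fin (size H) ⊎ Fin (size K) → Fin (size H) ⊎ Fin (size K) → Set)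
         (s t : Fin (size H) ⊎ Fin (size K))
         (G : Graph A) (h : Fin (size H) ⊎ Fin (size K) → Fin (size G)) : Set₁ where
  field
    surjective : ∀ v → ∃[ x ] h x ≡ v
    kernel     : ∀ x y → (h x ≡ h y) ⇔ EqClosure R x y
    edges      : ∀ a u v → edge G a u v ⇔ (∃[ x ] ∃[ y ] (SumEdge H K a x y × h x ≡ u × h y ≡ v))
    srcOK      : src G ≡ h s
    tgtOK      : tgt G ≡ h t

IsSeries : {A : Set} → Graph A → Graph A → Graph A → Set₁
IsSeries H K G = ∃[ h ] IsGluing H K (SeriesGen H K) (inj₁ (src H)) (inj₂ (tgt K)) G h

IsParallel : {A : Set} → Graph A → Graph A → Graph A → Set₁
IsParallel H K G = ∃[ h ] IsGluing H K (ParGen H K) (inj₁ (src H)) (inj₂ (tgt K)) G h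

-- Graph language 𝒢(t) (closed under isomorphism by construction)

data _∈𝒢_ {A : Set} : Graph A → Term A → Set₁ where
  mem-atom : ∀ {G a} → size G ≡ 2 → src G ≢ tgt G →
             (∀ b u v → edge G b u v ⇔ (b ≡ a × u ≡ src G × v ≡ tgt G)) →
             G ∈𝒢 atom a
  mem-one  : ∀ {G} → size G ≡ 1 → src G ≡ tgt G →
             (∀ b u v → ¬ edge G b u v) → G ∈𝒢 one
  -- no constructor for zer: 𝒢(0) = ∅
  mem-top  : ∀ {G} → size G ≡ 2 → src G ≢ tgt G →
             (∀ b u v → ¬ edge G b u v) → G ∈𝒢 top
  mem-seq  : ∀ {G H K t s} → H ∈𝒢 t → K ∈𝒢 s → IsSeries H K G → G ∈𝒢 (t ⨾ s)
  mem-par  : ∀ {G H K t s} → H ∈𝒢 t → K ∈𝒢 s → IsParallel H K G → G ∈𝒢 (t ⊓ s)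
  mem-sumˡ : ∀ {G t s} → G ∈𝒢 t → G ∈𝒢 (t ⊕ s)
  mem-sumʳ : ∀ {G t s} → G ∈𝒢 s → G ∈𝒢 (t ⊕ s)
  mem-conv : ∀ {G t} → swap G ∈𝒢 t → G ∈𝒢 (t ˘)
  mem-star : ∀ {G t} (n : ℕ) → G ∈𝒢 pow t n → G ∈𝒢 (t ⋆)

record PathDecomposition {A : Set} (G : Graph A) : Set where
  field
    len  : ℕ
    bag  : Fin len → Subset (size G)
    covers     : ∀ v → ∃[ i ] v ∈ bag i
    edgeCovers : ∀ a u v → edge G a u v → ∃[ i ] (u ∈ bag i × v ∈ bag i)
    interpolates : ∀ i j k → i F.≤ j → j F.≤ k → ∀ v → v ∈ bag i → v ∈ bag k → v ∈ bag j
open PathDecomposition public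

width : {A : Set} {G : Graph A} → PathDecomposition G → ℕ
width D = foldr _⊔_ 0 (tabulate (λ i → ∣ bag D i ∣ ∸ 1))

PathwidthAtMost : {A : Set} → Graph A → ℕ → Set
PathwidthAtMost G k = Σ (PathDecomposition G) (λ D → width D ≤ k)

-- By induction on t we build a path decomposition of width iw t whose first bag
-- contains the source and whose last bag contains the target.  For t ; s the two
-- decompositions are concatenated: the only vertex they share is the glued
-- target/source, which sits in the last bag of one and the first bag of the other.
-- For t ∩ s the common source is added to every bag of the first decomposition and
-- the common target to every bag of the second before concatenating; this costs one
-- vertex per bag, and 1 + max (iw t) (iw s) ≤ iw t + iw s since every width is at
-- least 1.  Converse reverses the order of the bags; sums and stars only need a
-- weaker bound.
module Submission where

open import Defs
open import Data.Empty using (⊥-elim)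
open import Data.Fin as Fin using (Fin; zero; suc; toℕ; fromℕ; opposite; splitAt; _↑ˡ_; _↑ʳ_)
open import Data.Fin.Properties
  using (toℕ-↑ˡ; toℕ-↑ʳ; toℕ<n; ≤fromℕ; opposite-prop; opposite-involutive; splitAt⁻¹-↑ˡ; splitAt⁻¹-↑ʳ)
open import Data.Fin.Subset using (Subset; inside; outside; ⁅_⁆; _∪_; ∣_∣) renaming (⊥ to ∅; _∈_ to _∈ˢ_)
open import Data.Fin.Subset.Properties using (x∈⁅x⁆; x∈⁅y⁆⇒x≡y; x∈p∪q⁺; x∈p∪q⁻; ∉⊥; ∣⊥∣≡0; ∣⁅x⁆∣≡1)
open import Data.List using (List; []; _∷_; _++_; map; length; foldr)
open import Data.List.Properties using (length-++; length-map; foldr-preservesᵇ)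
open import Data.List.Membership.Propositional using (_∈_)
open import Data.List.Membership.Propositional.Properties using (∈-map⁺; ∈-map⁻; ∈-++⁺ʳ)
open import Data.List.Relation.Unary.All.Properties using (tabulate⁺)
open import Data.List.Relation.Unary.Any using (here; there)
open import Data.Nat using (ℕ; zero; suc; _≤_; _⊔_; _+_; _∸_; z≤n; s≤s)
open import Data.Nat.Properties
open import Data.Product using (∃-syntax; _×_; _,_; proj₁; proj₂)
open import Data.Sum using (_⊎_; inj₁; inj₂)
open import Data.Sum.Properties using (inj₁-injective; inj₂-injective)
open import Data.Vec using ([]; _∷_)
open import Data.Vec.Functional using () renaming (_++_ to _++ᵛ_)
open import Data.Vec.Functional.Properties using (lookup-++ˡ; lookup-++ʳ)
open import Function using (_∘_)
open import Function.Bundles using (Equivalence)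
open import Relation.Binary.Definitions using (Symmetric; Transitive)
open import Relation.Binary.Structures using (IsEquivalence)
open import Relation.Binary.Construct.Closure.Equivalence as EqClosure using (EqClosure)
open import Relation.Binary.Construct.Closure.ReflexiveTransitive using (return)
open import Relation.Binary.Construct.Closure.Symmetric using (fwd)
open import Relation.Binary.PropositionalEquality
open import Relation.Nullary using (¬_; Dec; yes; no)

∣p∪q∣≤∣p∣+∣q∣ : ∀ {n} (p q : Subset n) → ∣ p ∪ q ∣ ≤ ∣ p ∣ + ∣ q ∣
∣p∪q∣≤∣p∣+∣q∣ []            []            = z≤n
∣p∪q∣≤∣p∣+∣q∣ (outside ∷ p) (outside ∷ q) = ∣p∪q∣≤∣p∣+∣q∣ p q
∣p∪q∣≤∣p∣+∣q∣ (outside ∷ p) (inside  ∷ q) =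
  ≤-trans (s≤s (∣p∪q∣≤∣p∣+∣q∣ p q)) (≤-reflexive (sym (+-suc ∣ p ∣ ∣ q ∣)))
∣p∪q∣≤∣p∣+∣q∣ (inside  ∷ p) (outside ∷ q) = s≤s (∣p∪q∣≤∣p∣+∣q∣ p q)
∣p∪q∣≤∣p∣+∣q∣ (inside  ∷ p) (inside  ∷ q) =
  s≤s (≤-trans (∣p∪q∣≤∣p∣+∣q∣ p q) (+-monoʳ-≤ ∣ p ∣ (n≤1+n ∣ q ∣)))

toSubset : ∀ {n} → List (Fin n) → Subset n
toSubset = foldr (λ x p → ⁅ x ⁆ ∪ p) ∅

∣toSubset∣≤length : ∀ {n} (xs : List (Fin n)) → ∣ toSubset xs ∣ ≤ length xs
∣toSubset∣≤length {n} []       = ≤-reflexive (∣⊥∣≡0 n)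
∣toSubset∣≤length     (x ∷ xs) = begin
  ∣ ⁅ x ⁆ ∪ toSubset xs ∣      ≤⟨ ∣p∪q∣≤∣p∣+∣q∣ ⁅ x ⁆ (toSubset xs) ⟩
  ∣ ⁅ x ⁆ ∣ + ∣ toSubset xs ∣  ≡⟨ cong (_+ ∣ toSubset xs ∣) (∣⁅x⁆∣≡1 x) ⟩
  suc ∣ toSubset xs ∣          ≤⟨ s≤s (∣toSubset∣≤length xs) ⟩
  suc (length xs)              ∎
  where open ≤-Reasoning

∈-toSubset⁺ : ∀ {n} {x : Fin n} {xs} → x ∈ xs → x ∈ˢ toSubset xs
∈-toSubset⁺ {xs = y ∷ _} (here refl) = x∈p∪q⁺ (inj₁ (x∈⁅x⁆ y))
∈-toSubset⁺             (there x∈)   = x∈p∪q⁺ (inj₂ (∈-toSubset⁺ x∈))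

∈-toSubset⁻ : ∀ {n} {x : Fin n} xs → x ∈ˢ toSubset xs → x ∈ xs
∈-toSubset⁻ []       x∈ = ⊥-elim (∉⊥ x∈)
∈-toSubset⁻ (y ∷ xs) x∈ with x∈p∪q⁻ ⁅ y ⁆ (toSubset xs) x∈
... | inj₁ x∈⁅y⁆ = here (x∈⁅y⁆⇒x≡y y x∈⁅y⁆)
... | inj₂ x∈xs  = there (∈-toSubset⁻ xs x∈xs)

Interval : ∀ {n} → (Fin n → Set) → Set
Interval S = ∀ {i j k} → i Fin.≤ j → j Fin.≤ k → S i → S k → S j

↑ˡ-≤-cancel : ∀ {m} n {i j : Fin m} → i ↑ˡ n Fin.≤ j ↑ˡ n → i Fin.≤ j
↑ˡ-≤-cancel n {i} {j} = subst₂ _≤_ (toℕ-↑ˡ i n) (toℕ-↑ˡ j n)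

↑ʳ-≤-cancel : ∀ m {n} {i j : Fin n} → m ↑ʳ i Fin.≤ m ↑ʳ j → i Fin.≤ j
↑ʳ-≤-cancel m {i = i} {j} = +-cancelˡ-≤ m _ _ ∘ subst₂ _≤_ (toℕ-↑ʳ m i) (toℕ-↑ʳ m j)

↑ʳ≰↑ˡ : ∀ {m n} (i : Fin m) (j : Fin n) → ¬ (m ↑ʳ j Fin.≤ i ↑ˡ n)
↑ʳ≰↑ˡ {m} {n} i j le =
  <⇒≱ (toℕ<n i) (≤-trans (m≤m+n m (toℕ j)) (subst₂ _≤_ (toℕ-↑ʳ m j) (toℕ-↑ˡ i n) le))

fromℕ-+-suc : ∀ m n → fromℕ (m + suc n) ≡ suc m ↑ʳ fromℕ n
fromℕ-+-suc zero    n = refl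
fromℕ-+-suc (suc m) n = cong suc (fromℕ-+-suc m n)

opposite-≤ : ∀ {n} {i j : Fin n} → i Fin.≤ j → opposite j Fin.≤ opposite i
opposite-≤ {n} {i} {j} i≤j =
  subst₂ _≤_ (sym (opposite-prop j)) (sym (opposite-prop i)) (∸-monoʳ-≤ n (s≤s i≤j))

data Split (m n : ℕ) : Fin (m + n) → Set where
  left  : (i : Fin m) → Split m n (i ↑ˡ n)
  right : (j : Fin n) → Split m n (m ↑ʳ j)

split : ∀ m {n} (i : Fin (m + n)) → Split m n i
split m i with splitAt m i in eq
... | inj₁ a = subst (Split m _) (splitAt⁻¹-↑ˡ eq) (left a)
... | inj₂ b = subst (Split m _) (splitAt⁻¹-↑ʳ eq) (right b)

module _ {A : Set} (P : A → Set) {m n} (xs : Fin m → A) (ys : Fin n → A) where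

  ++ᵛ-all : (∀ i → P (xs i)) → (∀ j → P (ys j)) → ∀ k → P ((xs ++ᵛ ys) k)
  ++ᵛ-all Pxs Pys k with split m k
  ... | left i  = subst P (sym (lookup-++ˡ xs ys i)) (Pxs i)
  ... | right j = subst P (sym (lookup-++ʳ xs ys j)) (Pys j)

module _ {A : Set} (P : A → Set) {m n} (xs : Fin (suc m) → A) (ys : Fin (suc n) → A) where

  private
    ++ˡ⁺ : ∀ i → P (xs i) → P ((xs ++ᵛ ys) (i ↑ˡ suc n))
    ++ˡ⁺ i = subst P (sym (lookup-++ˡ xs ys i))
    ++ˡ⁻ : ∀ i → P ((xs ++ᵛ ys) (i ↑ˡ suc n)) → P (xs i)
    ++ˡ⁻ i = subst P (lookup-++ˡ xs ys i)
    ++ʳ⁺ : ∀ j → P (ys j) → P ((xs ++ᵛ ys) (suc m ↑ʳ j))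
    ++ʳ⁺ j = subst P (sym (lookup-++ʳ xs ys j))
    ++ʳ⁻ : ∀ j → P ((xs ++ᵛ ys) (suc m ↑ʳ j)) → P (ys j)
    ++ʳ⁻ j = subst P (lookup-++ʳ xs ys j)

  interval-++ : Interval (P ∘ xs) → Interval (P ∘ ys) →
                (∀ {i j} → P (xs i) → P (ys j) → P (xs (fromℕ m)) × P (ys zero)) →
                Interval (P ∘ (xs ++ᵛ ys))
  interval-++ I₁ I₂ meet {i} {j} {k} i≤j j≤k Pi Pk
    with split (suc m) i | split (suc m) j | split (suc m) k
  ... | left a  | left b  | left c  =
    ++ˡ⁺ b (I₁ (↑ˡ-≤-cancel _ i≤j) (↑ˡ-≤-cancel _ j≤k) (++ˡ⁻ a Pi) (++ˡ⁻ c Pk))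
  ... | left a  | left b  | right c =
    ++ˡ⁺ b (I₁ (↑ˡ-≤-cancel _ i≤j) (≤fromℕ b) (++ˡ⁻ a Pi) (proj₁ (meet (++ˡ⁻ a Pi) (++ʳ⁻ c Pk))))
  ... | left a  | right b | right c =
    ++ʳ⁺ b (I₂ z≤n (↑ʳ-≤-cancel _ j≤k) (proj₂ (meet (++ˡ⁻ a Pi) (++ʳ⁻ c Pk))) (++ʳ⁻ c Pk))
  ... | right a | right b | right c =
    ++ʳ⁺ b (I₂ (↑ʳ-≤-cancel _ i≤j) (↑ʳ-≤-cancel _ j≤k) (++ʳ⁻ a Pi) (++ʳ⁻ c Pk))
  ... | right a | left b  | _       = ⊥-elim (↑ʳ≰↑ˡ b a i≤j)
  ... | _       | right b | left c  = ⊥-elim (↑ʳ≰↑ˡ c b j≤k)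

interval-opposite : ∀ {n} {S : Fin n → Set} → Interval S → Interval (S ∘ opposite)
interval-opposite I i≤j j≤k Si Sk = I (opposite-≤ j≤k) (opposite-≤ i≤j) Sk Si

interval-map : ∀ {X Y : Set} {n} (f : X → Y) {B : Fin n → List X} {y : Y} →
               (∀ {x x'} → f x ≡ y → f x' ≡ y → x ≡ x') →
               (∀ x → Interval (λ i → x ∈ B i)) → Interval (λ i → y ∈ map f (B i))
interval-map f fibre I i≤j j≤k y∈ y∈'
  with x  , x∈  , refl   ← ∈-map⁻ f y∈
  with x' , x'∈ , fx≡fx' ← ∈-map⁻ f y∈'
  with refl ← fibre refl (sym fx≡fx')
  = ∈-map⁺ f (I x i≤j j≤k x∈ x'∈)

interval-∷ : ∀ {X : Set} {n} {B : Fin n → List X} {x y : X} → Dec (x ≡ y) →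
             (x ≢ y → Interval (λ i → x ∈ B i)) → Interval (λ i → x ∈ y ∷ B i)
interval-∷ (yes x≡y) _ _   _   _          _          = here x≡y
interval-∷ (no x≢y)  _ _   _   (here x≡y) _          = ⊥-elim (x≢y x≡y)
interval-∷ (no x≢y)  _ _   _   _          (here x≡y) = ⊥-elim (x≢y x≡y)
interval-∷ (no x≢y)  I i≤j j≤k (there x∈) (there x∈') = there (I x≢y i≤j j≤k x∈ x∈')

-- Bags are lists rather than subsets so that images and concatenations are easy to
-- form; a repeated vertex only overestimates the size of its bag.
record Decomposition {A : Set} (G : Graph A) (w : ℕ) : Set where
  field
    end             : ℕ
    bags            : Fin (suc end) → List (Fin (size G))
    bag-small       : ∀ i → length (bags i) ≤ suc w
    covers-vertices : ∀ v → ∃[ i ] v ∈ bags i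
    covers-edges    : ∀ a u v → edge G a u v → ∃[ i ] (u ∈ bags i × v ∈ bags i)
    contiguous      : ∀ v → Interval (λ i → v ∈ bags i)
    src∈first       : src G ∈ bags zero
    tgt∈last        : tgt G ∈ bags (fromℕ end)
open Decomposition

module _ {A : Set} {G : Graph A} {w : ℕ} (D : Decomposition G w) where

  toPathDecomposition : PathDecomposition G
  toPathDecomposition = record
    { len          = suc (end D)
    ; bag          = toSubset ∘ bags D
    ; covers       = λ v → let i , v∈ = covers-vertices D v in i , ∈-toSubset⁺ v∈
    ; edgeCovers   = λ a u v e → let i , u∈ , v∈ = covers-edges D a u v e
                                 in i , ∈-toSubset⁺ u∈ , ∈-toSubset⁺ v∈
    ; interpolates = λ i j k i≤j j≤k v v∈i v∈k →
        ∈-toSubset⁺ (contiguous D v i≤j j≤k (∈-toSubset⁻ _ v∈i) (∈-toSubset⁻ _ v∈k))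
    }

  width-toPathDecomposition : width toPathDecomposition ≤ w
  width-toPathDecomposition = foldr-preservesᵇ {P = _≤ w} ⊔-lub z≤n (tabulate⁺ bag-width)
    where
    bag-width : ∀ i → ∣ toSubset (bags D i) ∣ ∸ 1 ≤ w
    bag-width i = ∸-monoˡ-≤ 1 (≤-trans (∣toSubset∣≤length (bags D i)) (bag-small D i))

weaken : ∀ {A} {G : Graph A} {w w'} → w ≤ w' → Decomposition G w → Decomposition G w'
weaken w≤w' D = record
  { end             = end D
  ; bags            = bags D
  ; bag-small       = λ i → ≤-trans (bag-small D i) (s≤s w≤w')
  ; covers-vertices = covers-vertices D
  ; covers-edges    = covers-edges D
  ; contiguous      = contiguous D
  ; src∈first       = src∈first D
  ; tgt∈last        = tgt∈last D
  }

reverse : ∀ {A} {G : Graph A} {w} → Decomposition (swap G) w → Decomposition G w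
reverse {G = G} D = record
  { end             = end D
  ; bags            = bags D ∘ opposite
  ; bag-small       = bag-small D ∘ opposite
  ; covers-vertices = λ v → let i , v∈ = covers-vertices D v in opposite i , back v∈
  ; covers-edges    = λ a u v e → let i , u∈ , v∈ = covers-edges D a u v e
                                  in opposite i , back u∈ , back v∈
  ; contiguous      = interval-opposite ∘ contiguous D
  ; src∈first       = tgt∈last D
  ; tgt∈last        = subst (λ i → tgt G ∈ bags D i) (sym (opposite-involutive zero)) (src∈first D)
  }
  where
  back : ∀ {v i} → v ∈ bags D i → v ∈ bags D (opposite (opposite i))
  back {v} {i} = subst (λ k → v ∈ bags D k) (sym (opposite-involutive i))

singleBag : ∀ {A} {G : Graph A} {w} (B : List (Fin (size G))) →
            length B ≤ suc w → (∀ v → v ∈ B) → Decomposition G w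
singleBag {G = G} B small all = record
  { end             = 0
  ; bags            = λ _ → B
  ; bag-small       = λ _ → small
  ; covers-vertices = λ v → zero , all v
  ; covers-edges    = λ _ u v _ → zero , all u , all v
  ; contiguous      = λ v _ _ v∈ _ → v∈
  ; src∈first       = all (src G)
  ; tgt∈last        = all (tgt G)
  }

module _ {X : Set} (R : X → X → Set) where

  Endpoint : X → Set
  Endpoint x = ∃[ y ] (R x y ⊎ R y x)

  SameOrEndpoints : X → X → Set
  SameOrEndpoints x y = x ≡ y ⊎ (Endpoint x × Endpoint y)

  sameOrEndpoints-isEquivalence : IsEquivalence SameOrEndpoints
  sameOrEndpoints-isEquivalence = record { refl = inj₁ refl ; sym = symmetric ; trans = transitive }
    where
    symmetric : Symmetric SameOrEndpoints
    symmetric (inj₁ x≡y)       = inj₁ (sym x≡y)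
    symmetric (inj₂ (ex , ey)) = inj₂ (ey , ex)
    transitive : Transitive SameOrEndpoints
    transitive (inj₁ refl)      q                = q
    transitive (inj₂ p)         (inj₁ refl)      = inj₂ p
    transitive (inj₂ (ex , _))  (inj₂ (_ , ez))  = inj₂ (ex , ez)

  eqClosure⇒sameOrEndpoints : ∀ {x y} → EqClosure R x y → SameOrEndpoints x y
  eqClosure⇒sameOrEndpoints =
    EqClosure.fold sameOrEndpoints-isEquivalence (λ {x} {y} r → inj₂ ((y , inj₁ r) , (x , inj₂ r)))

module _ {A : Set} {H K G : Graph A} {R s t h} (gl : IsGluing H K R s t G h) where

  identified⇒sameOrEndpoints : ∀ {x y} → h x ≡ h y → SameOrEndpoints R x y
  identified⇒sameOrEndpoints {x} {y} =
    eqClosure⇒sameOrEndpoints R ∘ Equivalence.to (IsGluing.kernel gl x y)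

  related⇒identified : ∀ {x y} → R x y → h x ≡ h y
  related⇒identified {x} {y} r = Equivalence.from (IsGluing.kernel gl x y) (return (fwd r))

series-endpointˡ : ∀ {A} {H K : Graph A} {x} → Endpoint (SeriesGen H K) (inj₁ x) → x ≡ tgt H
series-endpointˡ (_ , inj₁ glue) = refl
series-endpointˡ (_ , inj₂ ())

series-endpointʳ : ∀ {A} {H K : Graph A} {y} → Endpoint (SeriesGen H K) (inj₂ y) → y ≡ src K
series-endpointʳ (_ , inj₁ ())
series-endpointʳ (_ , inj₂ glue) = refl

parallel-endpointˡ : ∀ {A} {H K : Graph A} {x} →
                     Endpoint (ParGen H K) (inj₁ x) → x ≡ src H ⊎ x ≡ tgt H
parallel-endpointˡ (_ , inj₁ glueSrc) = inj₁ refl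
parallel-endpointˡ (_ , inj₁ glueTgt) = inj₂ refl
parallel-endpointˡ (_ , inj₂ ())

parallel-endpointʳ : ∀ {A} {H K : Graph A} {y} →
                     Endpoint (ParGen H K) (inj₂ y) → y ≡ src K ⊎ y ≡ tgt K
parallel-endpointʳ (_ , inj₁ ())
parallel-endpointʳ (_ , inj₂ glueSrc) = inj₁ refl
parallel-endpointʳ (_ , inj₂ glueTgt) = inj₂ refl

length-++-map-≤ : ∀ {X Y : Set} (E : List Y) (f : X → Y) (B : List X) {e w} →
                  length E ≤ e → length B ≤ suc w → length (E ++ map f B) ≤ suc (e + w)
length-++-map-≤ E f B {e} {w} E≤e B≤w = begin
  length (E ++ map f B)        ≡⟨ length-++ E ⟩
  length E + length (map f B)  ≡⟨ cong (length E +_) (length-map f B) ⟩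
  length E + length B          ≤⟨ +-mono-≤ E≤e B≤w ⟩
  e + suc w                    ≡⟨ +-suc e w ⟩
  suc (e + w)                  ∎
  where open ≤-Reasoning

module Gluing {A : Set} {H K G : Graph A} {R} {h : Fin (size H) ⊎ Fin (size K) → Fin (size G)}
            (gl : IsGluing H K R (inj₁ (src H)) (inj₂ (tgt K)) G h)
            {w₁ w₂} (D₁ : Decomposition H w₁) (D₂ : Decomposition K w₂)
            (E₁ E₂ : List (Fin (size G))) where

  open IsGluing gl

  bagsˡ : Fin (suc (end D₁)) → List (Fin (size G))
  bagsˡ i = E₁ ++ map (h ∘ inj₁) (bags D₁ i)

  bagsʳ : Fin (suc (end D₂)) → List (Fin (size G))
  bagsʳ j = E₂ ++ map (h ∘ inj₂) (bags D₂ j)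

  private
    B : Fin (suc (end D₁) + suc (end D₂)) → List (Fin (size G))
    B = bagsˡ ++ᵛ bagsʳ

    e = length E₁ ⊔ length E₂

    inˡ : ∀ {x i} → x ∈ bags D₁ i → h (inj₁ x) ∈ B (i ↑ˡ _)
    inˡ {i = i} = subst (_ ∈_) (sym (lookup-++ˡ bagsˡ bagsʳ i)) ∘ ∈-++⁺ʳ E₁ ∘ ∈-map⁺ _

    inʳ : ∀ {y j} → y ∈ bags D₂ j → h (inj₂ y) ∈ B (suc (end D₁) ↑ʳ j)
    inʳ {j = j} = subst (_ ∈_) (sym (lookup-++ʳ bagsˡ bagsʳ j)) ∘ ∈-++⁺ʳ E₂ ∘ ∈-map⁺ _

    small : ∀ k → length (B k) ≤ suc (e + (w₁ ⊔ w₂))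
    small = ++ᵛ-all (λ L → length L ≤ suc (e + (w₁ ⊔ w₂))) bagsˡ bagsʳ
      (λ i → length-++-map-≤ E₁ _ _ (m≤m⊔n _ _) (≤-trans (bag-small D₁ i) (s≤s (m≤m⊔n w₁ w₂))))
      (λ j → length-++-map-≤ E₂ _ _ (m≤n⊔m _ _) (≤-trans (bag-small D₂ j) (s≤s (m≤n⊔m w₁ w₂))))

    vertices-covered : ∀ v → ∃[ k ] v ∈ B k
    vertices-covered v with surjective v
    ... | inj₁ x , refl = let i , x∈ = covers-vertices D₁ x in i ↑ˡ _ , inˡ x∈
    ... | inj₂ y , refl = let j , y∈ = covers-vertices D₂ y in suc (end D₁) ↑ʳ j , inʳ y∈

    edges-covered : ∀ a u v → edge G a u v → ∃[ k ] (u ∈ B k × v ∈ B k)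
    edges-covered a u v uv with Equivalence.to (edges a u v) uv
    ... | inj₁ x , inj₁ y , xy , refl , refl =
      let i , x∈ , y∈ = covers-edges D₁ a x y xy in i ↑ˡ _ , inˡ x∈ , inˡ y∈
    ... | inj₂ x , inj₂ y , xy , refl , refl =
      let j , x∈ , y∈ = covers-edges D₂ a x y xy in suc (end D₁) ↑ʳ j , inʳ x∈ , inʳ y∈
    ... | inj₁ _ , inj₂ _ , () , _
    ... | inj₂ _ , inj₁ _ , () , _

    tgt∈B-last : tgt G ∈ B (fromℕ (end D₁ + suc (end D₂)))
    tgt∈B-last = subst (λ k → tgt G ∈ B k) (sym (fromℕ-+-suc (end D₁) (end D₂)))
                 (subst (_∈ B (suc (end D₁) ↑ʳ fromℕ (end D₂))) (sym tgtOK) (inʳ (tgt∈last D₂)))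

  decomposition : (∀ v → Interval (λ i → v ∈ bagsˡ i)) → (∀ v → Interval (λ j → v ∈ bagsʳ j)) →
         (∀ {v i j} → v ∈ bagsˡ i → v ∈ bagsʳ j → v ∈ bagsˡ (fromℕ (end D₁)) × v ∈ bagsʳ zero) →
         Decomposition G (e + (w₁ ⊔ w₂))
  decomposition contiguousˡ contiguousʳ meet = record
    { end             = end D₁ + suc (end D₂)
    ; bags            = B
    ; bag-small       = small
    ; covers-vertices = vertices-covered
    ; covers-edges    = edges-covered
    ; contiguous      = λ v → interval-++ (v ∈_) bagsˡ bagsʳ (contiguousˡ v) (contiguousʳ v) meet
    ; src∈first       = subst (_∈ B zero) (sym srcOK) (inˡ (src∈first D₁))
    ; tgt∈last        = tgt∈B-last
    }

module SeriesGluing {A : Set} {H K G : Graph A} {h : Fin (size H) ⊎ Fin (size K) → Fin (size G)}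
                    (gl : IsGluing H K (SeriesGen H K) (inj₁ (src H)) (inj₂ (tgt K)) G h) where

  fibreˡ : ∀ {v x x'} → h (inj₁ x) ≡ v → h (inj₁ x') ≡ v → x ≡ x'
  fibreˡ refl hx'≡hx with identified⇒sameOrEndpoints gl (sym hx'≡hx)
  ... | inj₁ x≡x'       = inj₁-injective x≡x'
  ... | inj₂ (ex , ex') = trans (series-endpointˡ ex) (sym (series-endpointˡ ex'))

  fibreʳ : ∀ {v y y'} → h (inj₂ y) ≡ v → h (inj₂ y') ≡ v → y ≡ y'
  fibreʳ refl hy'≡hy with identified⇒sameOrEndpoints gl (sym hy'≡hy)
  ... | inj₁ y≡y'       = inj₂-injective y≡y'
  ... | inj₂ (ey , ey') = trans (series-endpointʳ ey) (sym (series-endpointʳ ey'))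

  crossing : ∀ {x y} → h (inj₁ x) ≡ h (inj₂ y) → x ≡ tgt H × y ≡ src K
  crossing hx≡hy with identified⇒sameOrEndpoints gl hx≡hy
  ... | inj₁ ()
  ... | inj₂ (ex , ey) = series-endpointˡ ex , series-endpointʳ ey

series : ∀ {A} {H K G : Graph A} {w₁ w₂} →
         IsSeries H K G → Decomposition H w₁ → Decomposition K w₂ → Decomposition G (w₁ ⊔ w₂)
series (h , gl) D₁ D₂ = decomposition contiguousˡ contiguousʳ meet
  where
  open Gluing gl D₁ D₂ [] []
  open SeriesGluing gl

  contiguousˡ : ∀ v → Interval (λ i → v ∈ bagsˡ i)
  contiguousˡ v = interval-map (h ∘ inj₁) fibreˡ (contiguous D₁)

  contiguousʳ : ∀ v → Interval (λ j → v ∈ bagsʳ j)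
  contiguousʳ v = interval-map (h ∘ inj₂) fibreʳ (contiguous D₂)

  meet : ∀ {v i j} → v ∈ bagsˡ i → v ∈ bagsʳ j → v ∈ bagsˡ (fromℕ (end D₁)) × v ∈ bagsʳ zero
  meet v∈ˡ v∈ʳ
    with x , _ , refl  ← ∈-map⁻ _ v∈ˡ
    with y , _ , hx≡hy ← ∈-map⁻ _ v∈ʳ
    with refl , refl   ← crossing hx≡hy
    = ∈-map⁺ _ (tgt∈last D₁) , subst (_∈ bagsʳ zero) (sym hx≡hy) (∈-map⁺ _ (src∈first D₂))

module ParallelGluing {A : Set} {H K G : Graph A} {h : Fin (size H) ⊎ Fin (size K) → Fin (size G)}
                      (gl : IsGluing H K (ParGen H K) (inj₁ (src H)) (inj₂ (tgt K)) G h) where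

  srcˡ : h (inj₁ (src H)) ≡ src G
  srcˡ = sym (IsGluing.srcOK gl)

  tgtʳ : h (inj₂ (tgt K)) ≡ tgt G
  tgtʳ = sym (IsGluing.tgtOK gl)

  srcʳ : h (inj₂ (src K)) ≡ src G
  srcʳ = trans (sym (related⇒identified gl glueSrc)) srcˡ

  tgtˡ : h (inj₁ (tgt H)) ≡ tgt G
  tgtˡ = trans (related⇒identified gl glueTgt) tgtʳ

  private
    endpointˡ≢src : ∀ {x} → h (inj₁ x) ≢ src G → Endpoint (ParGen H K) (inj₁ x) → x ≡ tgt H
    endpointˡ≢src hx≢s ex with parallel-endpointˡ ex
    ... | inj₁ refl  = ⊥-elim (hx≢s srcˡ)
    ... | inj₂ x≡tgt = x≡tgt

    endpointʳ≢tgt : ∀ {y} → h (inj₂ y) ≢ tgt G → Endpoint (ParGen H K) (inj₂ y) → y ≡ src K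
    endpointʳ≢tgt hy≢t ey with parallel-endpointʳ ey
    ... | inj₁ y≡src = y≡src
    ... | inj₂ refl  = ⊥-elim (hy≢t tgtʳ)

  -- The hypothesis is needed: when src K = tgt K, both src H and tgt H lie over src G.
  fibreˡ : ∀ {v x x'} → v ≢ src G → h (inj₁ x) ≡ v → h (inj₁ x') ≡ v → x ≡ x'
  fibreˡ v≢s refl hx'≡hx with identified⇒sameOrEndpoints gl (sym hx'≡hx)
  ... | inj₁ x≡x'       = inj₁-injective x≡x'
  ... | inj₂ (ex , ex') =
    trans (endpointˡ≢src v≢s ex) (sym (endpointˡ≢src (v≢s ∘ trans (sym hx'≡hx)) ex'))

  fibreʳ : ∀ {v y y'} → v ≢ tgt G → h (inj₂ y) ≡ v → h (inj₂ y') ≡ v → y ≡ y'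
  fibreʳ v≢t refl hy'≡hy with identified⇒sameOrEndpoints gl (sym hy'≡hy)
  ... | inj₁ y≡y'       = inj₂-injective y≡y'
  ... | inj₂ (ey , ey') =
    trans (endpointʳ≢tgt v≢t ey) (sym (endpointʳ≢tgt (v≢t ∘ trans (sym hy'≡hy)) ey'))

  crossing : ∀ {x y} → h (inj₁ x) ≡ h (inj₂ y) → h (inj₁ x) ≡ src G ⊎ h (inj₁ x) ≡ tgt G
  crossing hx≡hy with identified⇒sameOrEndpoints gl hx≡hy
  ... | inj₁ ()
  ... | inj₂ (ex , _) with parallel-endpointˡ ex
  ...   | inj₁ refl = inj₁ srcˡ
  ...   | inj₂ refl = inj₂ tgtˡ

parallel : ∀ {A} {H K G : Graph A} {w₁ w₂} →
           IsParallel H K G → Decomposition H w₁ → Decomposition K w₂ →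
           Decomposition G (suc (w₁ ⊔ w₂))
parallel {G = G} (h , gl) D₁ D₂ = decomposition contiguousˡ contiguousʳ meet
  where
  open Gluing gl D₁ D₂ (src G ∷ []) (tgt G ∷ [])
  open ParallelGluing gl

  shared : ∀ {v i j} → v ∈ bagsˡ i → v ∈ bagsʳ j → v ≡ src G ⊎ v ≡ tgt G
  shared (here v≡s) _          = inj₁ v≡s
  shared (there _)  (here v≡t) = inj₂ v≡t
  shared (there v∈ˡ) (there v∈ʳ)
    with x , _ , refl  ← ∈-map⁻ _ v∈ˡ
    with y , _ , hx≡hy ← ∈-map⁻ _ v∈ʳ
    = crossing hx≡hy

  contiguousˡ : ∀ v → Interval (λ i → v ∈ bagsˡ i)
  contiguousˡ v =
    interval-∷ (v Fin.≟ src G) (λ v≢s → interval-map (h ∘ inj₁) (fibreˡ v≢s) (contiguous D₁))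

  contiguousʳ : ∀ v → Interval (λ j → v ∈ bagsʳ j)
  contiguousʳ v =
    interval-∷ (v Fin.≟ tgt G) (λ v≢t → interval-map (h ∘ inj₂) (fibreʳ v≢t) (contiguous D₂))

  meet : ∀ {v i j} → v ∈ bagsˡ i → v ∈ bagsʳ j → v ∈ bagsˡ (fromℕ (end D₁)) × v ∈ bagsʳ zero
  meet v∈ˡ v∈ʳ with shared v∈ˡ v∈ʳ
  ... | inj₁ refl = here refl , there (subst (_∈ _) srcʳ (∈-map⁺ _ (src∈first D₂)))
  ... | inj₂ refl = there (subst (_∈ _) tgtˡ (∈-map⁺ _ (tgt∈last D₁))) , here refl

exhaust-Fin2 : ∀ {m} → m ≡ 2 → {x y : Fin m} → x ≢ y → ∀ v → v ∈ x ∷ y ∷ []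
exhaust-Fin2 refl {zero}     {zero}     x≢y _          = ⊥-elim (x≢y refl)
exhaust-Fin2 refl {suc zero} {suc zero} x≢y _          = ⊥-elim (x≢y refl)
exhaust-Fin2 refl {zero}     {suc zero} _   zero       = here refl
exhaust-Fin2 refl {zero}     {suc zero} _   (suc zero) = there (here refl)
exhaust-Fin2 refl {suc zero} {zero}     _   zero       = there (here refl)
exhaust-Fin2 refl {suc zero} {zero}     _   (suc zero) = here refl

exhaust-Fin1 : ∀ {m} → m ≡ 1 → (x v : Fin m) → v ∈ x ∷ []
exhaust-Fin1 refl zero zero = here refl

1≤iw : ∀ {A} (t : Term A) → 1 ≤ iw t
1≤iw (atom a) = ≤-refl
1≤iw one      = ≤-refl
1≤iw zer      = ≤-refl
1≤iw top      = ≤-refl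
1≤iw (t ⨾ s)  = ≤-trans (1≤iw t) (m≤m⊔n _ _)
1≤iw (t ⊕ s)  = ≤-trans (1≤iw t) (m≤m⊔n _ _)
1≤iw (t ⊓ s)  = ≤-trans (1≤iw t) (m≤m+n _ _)
1≤iw (t ˘)    = 1≤iw t
1≤iw (t ⋆)    = 1≤iw t

iw-pow≤iw : ∀ {A} (t : Term A) n → iw (pow t n) ≤ iw t
iw-pow≤iw t zero    = 1≤iw t
iw-pow≤iw t (suc n) = ⊔-lub ≤-refl (iw-pow≤iw t n)

1+m⊔n≤m+n : ∀ {m n} → 1 ≤ m → 1 ≤ n → suc (m ⊔ n) ≤ m + n
1+m⊔n≤m+n {m} {n} 1≤m 1≤n =
  ⊔-lub (≤-trans (≤-reflexive (+-comm 1 m)) (+-monoʳ-≤ m 1≤n)) (+-monoˡ-≤ n 1≤m)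

decompose : ∀ {A} (t : Term A) {G : Graph A} → G ∈𝒢 t → Decomposition G (iw t)
decompose (atom a) (mem-atom size≡2 s≢t _) = singleBag _ ≤-refl (exhaust-Fin2 size≡2 s≢t)
decompose top      (mem-top size≡2 s≢t _)  = singleBag _ ≤-refl (exhaust-Fin2 size≡2 s≢t)
decompose one {G}  (mem-one size≡1 _ _)    = singleBag _ (s≤s z≤n) (exhaust-Fin1 size≡1 (src G))
decompose (t ⨾ s)  (mem-seq H∈ K∈ G≅H⨾K)   = series G≅H⨾K (decompose t H∈) (decompose s K∈)
decompose (t ⊓ s)  (mem-par H∈ K∈ G≅H∥K)   =
  weaken (1+m⊔n≤m+n (1≤iw t) (1≤iw s)) (parallel G≅H∥K (decompose t H∈) (decompose s K∈))
decompose (t ⊕ s)  (mem-sumˡ G∈)           = weaken (m≤m⊔n _ _) (decompose t G∈)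
decompose (t ⊕ s)  (mem-sumʳ G∈)           = weaken (m≤n⊔m _ _) (decompose s G∈)
decompose (t ˘)    (mem-conv G∈)           = reverse (decompose t G∈)
decompose (t ⋆)    (mem-star n G∈)         = weaken (iw-pow≤iw t n) (decompose (pow t n) G∈)

proposition2p6 : {A : Set} (t : Term A) (G : Graph A) → G ∈𝒢 t → PathwidthAtMost G (iw t)
proposition2p6 t G G∈t = toPathDecomposition D , width-toPathDecomposition D
  where
  D : Decomposition G (iw t)
  D = decompose t G∈t
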